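{- Let $n\geq 4$ and let $G$ be a graph with $G\to K_n$. Then in any red/blue colouring of the edges of $G$, if there is a monochromatic copy of $K_{n+1}$ then there is a monochromatic copy of $K_n+K_{n-1}$.
   Context: All graphs are finite and simple. $G\to H$ means that every colouring of the edges of $G$ with two colours (red and blue) contains a monochromatic copy of $H$. $K_m$ denotes the complete graph on $m$ vertices, and $K_n+K_{n-1}$ is the disjoint union of a $K_n$ and a vertex-disjoint $K_{n-1}$; a monochromatic copy of it is one in which all edges have the same colour. -}

module Defs where

open import Data.Nat using (ℕ)
open import Data.Fin using (Fin)
open import Data.Bool using (Bool)
open import Data.Sum using (_⊎_; inj₁; inj₂)
open import Data.Product using (Σ; ∃; _×_)
open import Relation.Binary.PropositionalEquality using (_≡_)
open import Relation.Nullary using (¬_)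
open import Function.Definitions using (Injective)

record Graph : Set₁ where
  field
    v     : ℕ
    Adj   : Fin v → Fin v → Set
    sym   : ∀ {x y} → Adj x y → Adj y x
    irref : ∀ {x} → ¬ Adj x x
open Graph public

-- A red/blue edge colouring: a symmetric assignment of a colour (Bool;
-- say true = red, false = blue) to every pair of vertices; only the
-- values on edges matter.
record Colouring (G : Graph) : Set where
  field
    col     : Fin (v G) → Fin (v G) → Bool
    col-sym : ∀ x y → col x y ≡ col y x
open Colouring public

data TwoCliqueAdj {n m : ℕ} : Fin n ⊎ Fin m → Fin n ⊎ Fin m → Set where
  left  : ∀ {i j} → ¬ i ≡ j → TwoCliqueAdj (inj₁ i) (inj₁ j)
  right : ∀ {i j} → ¬ i ≡ j → TwoCliqueAdj (inj₂ i) (inj₂ j)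

MonoCopy : (G : Graph) → Colouring G → Bool →
           (V : Set) → (V → V → Set) → Set
MonoCopy G c b V A =
  Σ (V → Fin (v G)) λ f →
    Injective _≡_ _≡_ f ×
    (∀ {p q} → A p q → Adj G (f p) (f q) × col c (f p) (f q) ≡ b)

MonoK : (G : Graph) → Colouring G → ℕ → Set
MonoK G c m = ∃ λ b → MonoCopy G c b (Fin m) (λ i j → ¬ i ≡ j)

MonoKK : (G : Graph) → Colouring G → ℕ → ℕ → Set
MonoKK G c n m = ∃ λ b → MonoCopy G c b (Fin n ⊎ Fin m) TwoCliqueAdj

Arrows : Graph → ℕ → Set
Arrows G m = (c : Colouring G) → MonoK G c m

module Submission where

-- Exchanging colours, the K_{n+1} S is red.  We apply G → K_n to two
-- recolourings of G.  Each labels a few vertices (those of S, then those of S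
-- and of a blue K_n), recolours the edges between labelled vertices by a fixed
-- pattern on the labels, forces the edges from some labels to the outside to
-- one colour, and keeps all other colours.  For an arbitrary such "scheme" we
-- prove first: (extraction) a monochromatic K_{k+1} of the recolouring through
-- an unlabelled vertex gives a K_k of that colour in the original colouring
-- with at most one labelled vertex; (covering) a monochromatic K_k on labelled
-- vertices cannot exist if the label classes it may meet have fewer than k
-- vertices.  The finitely many conditions on label patterns are decided by
-- evaluation.  Step 1 either finishes or yields a blue K_n meeting S at most
-- in s₀ or s₁; Step 2 then always finishes.

open import Defs hiding (sym)
open import Data.Nat using (ℕ; zero; suc; _≤_; _<_; _+_; _∸_; s≤s; z≤n)
open import Data.Nat.Properties using (≤-refl; n≤1+n)
open import Data.Fin using (Fin; zero; suc; punchIn; _≟_; _↑ˡ_; _↑ʳ_)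
open import Data.Fin.Patterns using (0F; 1F; 2F; 3F; 4F; 5F; 6F; 7F; 8F; 9F)
open import Data.Fin.Properties using (any?; all?; pigeonhole; punchIn-injective; punchInᵢ≢i)
  renaming (<⇒≢ to <⇒≢ᶠ)
open import Data.Vec.Functional using (_++_)
open import Data.Vec.Functional.Properties using (lookup-++ˡ; lookup-++ʳ)
open import Data.Bool using (Bool; true; false; not; _∨_; _∧_)
open import Data.Bool.Properties using (not-involutive; not-injective; ∨-comm; ∧-comm) renaming (_≟_ to _≟ᴮ_)
open import Data.Maybe using (Maybe; just; nothing)
open import Data.Maybe.Properties using () renaming (≡-dec to ≡-dec-Maybe)
open import Data.List using (List; []; _∷_; length)
open import Data.List.Membership.Propositional using (_∈_)
open import Data.List.Relation.Unary.Any using (Any; here; there) renaming (any? to anyᴸ?)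
open import Data.List.Relation.Unary.All using (All; []; _∷_) renaming (lookup to lookupᴬ)
open import Data.Product using (Σ; ∃; _×_; _,_; proj₁; proj₂)
open import Data.Sum using (_⊎_; inj₁; inj₂)
open import Data.Empty using (⊥; ⊥-elim)
open import Function using (_∘_)
open import Function.Definitions using (Injective)
open import Relation.Nullary using (¬_; Dec; yes; no)
open import Relation.Nullary.Decidable using (_→-dec_; _⊎-dec_; _×-dec_; ¬?; True; toWitness; from-yes)
open import Relation.Binary.Definitions using (DecidableEquality)
open import Relation.Binary.PropositionalEquality
  using (_≡_; _≢_; refl; sym; trans; cong; cong₂; subst; module ≡-Reasoning)

Clique : (G : Graph) → (Fin (v G) → Fin (v G) → Bool) → Bool → ℕ → Set
Clique G κ X m = Σ (Fin m → Fin (v G)) λ f → Injective _≡_ _≡_ f ×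
  (∀ {p q} → p ≢ q → Adj G (f p) (f q) × κ (f p) (f q) ≡ X)

_∈Img_ : {A : Set} {m : ℕ} → A → (Fin m → A) → Set
u ∈Img h = ∃ λ i → u ≡ h i

_∈Img?_ : ∀ {k m} (u : Fin k) (h : Fin m → Fin k) → Dec (u ∈Img h)
u ∈Img? h = any? (λ i → u ≟ h i)

no-short-listing : ∀ {A : Set} {k m} (f : Fin k → A) → Injective _≡_ _≡_ f →
                   (h : Fin m → A) → m < k → (∀ a → f a ∈Img h) → ⊥
no-short-listing f f-inj h m<k listed
  with pigeonhole m<k (λ a → proj₁ (listed a))
... | a , a' , a<a' , same = <⇒≢ᶠ a<a' (f-inj f[a]≡f[a'])
  where
  open ≡-Reasoning
  f[a]≡f[a'] : f a ≡ f a'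
  f[a]≡f[a'] = begin
    f a                    ≡⟨ proj₂ (listed a) ⟩
    h (proj₁ (listed a))   ≡⟨ cong h same ⟩
    h (proj₁ (listed a'))  ≡⟨ sym (proj₂ (listed a')) ⟩
    f a'                   ∎

delete : ∀ {G κ X n} → Clique G κ X (suc n) → Fin (suc n) → Clique G κ X n
delete (f , f-inj , f-mono) j =
  f ∘ punchIn j ,
  (λ e → punchIn-injective j _ _ (f-inj e)) ,
  (λ p≢q → f-mono (p≢q ∘ punchIn-injective j _ _))

disjoint-union : ∀ {G} (c : Colouring G) {X n k}
                 (L : Clique G (col c) X n) (R : Clique G (col c) X k) →
                 (∀ i j → proj₁ L i ≢ proj₁ R j) →
                 MonoCopy G c X (Fin n ⊎ Fin k) TwoCliqueAdj
disjoint-union {G} c {X} {n} {k} (f , f-inj , f-mono) (g , g-inj , g-mono) apart =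
  h , h-inj , h-mono
  where
  h : Fin n ⊎ Fin k → Fin (v G)
  h (inj₁ i) = f i
  h (inj₂ j) = g j
  h-inj : Injective _≡_ _≡_ h
  h-inj {inj₁ i} {inj₁ i'} e = cong inj₁ (f-inj e)
  h-inj {inj₁ i} {inj₂ j}  e = ⊥-elim (apart i j e)
  h-inj {inj₂ j} {inj₁ i}  e = ⊥-elim (apart i j (sym e))
  h-inj {inj₂ j} {inj₂ j'} e = cong inj₂ (g-inj e)
  h-mono : ∀ {p q} → TwoCliqueAdj p q → Adj G (h p) (h q) × col c (h p) (h q) ≡ X
  h-mono (left i≢j)  = f-mono i≢j
  h-mono (right i≢j) = g-mono i≢j

-- An X-clique S on n+1 vertices and an X-clique Q on k vertices sharing at
-- most one vertex give an X-coloured K_n + K_k: delete the shared vertex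
-- (or any vertex) from S.
share-at-most-one : ∀ {G} (c : Colouring G) {X n k}
  (S : Clique G (col c) X (suc n)) (Q : Clique G (col c) X k) →
  (∀ {a a' i i'} → proj₁ Q a ≡ proj₁ S i → proj₁ Q a' ≡ proj₁ S i' → a ≡ a') →
  MonoCopy G c X (Fin n ⊎ Fin k) TwoCliqueAdj
share-at-most-one {G} c S@(s , s-inj , _) Q@(q , _ , _) shared
  with any? (λ i → s i ∈Img? q)
... | yes (j , a , sj≡qa) = disjoint-union c (delete {G} {col c} S j) Q apart
  where
  apart : ∀ i a' → s (punchIn j i) ≢ q a'
  apart i a' e = punchInᵢ≢i j i (s-inj (begin
    s (punchIn j i)  ≡⟨ e ⟩
    q a'             ≡⟨ cong q (shared (sym e) (sym sj≡qa)) ⟩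
    q a              ≡⟨ sym sj≡qa ⟩
    s j              ∎))
    where open ≡-Reasoning
... | no none = disjoint-union c (delete {G} {col c} S zero) Q
                  (λ i a e → none (punchIn zero i , a , e))

swap : ∀ {G} → Colouring G → Colouring G
swap c = record { col = λ u w → not (col c u w)
                ; col-sym = λ u w → cong not (col-sym c u w) }

from-swap : ∀ {G} (c : Colouring G) {X} {V : Set} {A : V → V → Set} →
            MonoCopy G (swap c) X V A → MonoCopy G c (not X) V A
from-swap c {X} (f , f-inj , f-mono) =
  f , f-inj , λ e → proj₁ (f-mono e) , not-injective (trans (proj₂ (f-mono e)) (sym (not-involutive X)))

to-swap : ∀ {G} (c : Colouring G) {X} {V : Set} {A : V → V → Set} →
          MonoCopy G c X V A → MonoCopy G (swap c) (not X) V A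
to-swap c (f , f-inj , f-mono) = f , f-inj , λ e → proj₁ (f-mono e) , cong not (proj₂ (f-mono e))

-- The recolouring of the proof keeps all colours outside a set of
-- labelled vertices.  A label is either free (its edges to the outside keep
-- their colour) or forced to a colour X (all its edges to the outside get
-- colour X).
data Kind : Set where
  free   : Kind
  forced : Bool → Kind

_≟ᴷ_ : DecidableEquality Kind
free     ≟ᴷ free      = yes refl
free     ≟ᴷ forced _  = no λ ()
forced _ ≟ᴷ free      = no λ ()
forced X ≟ᴷ forced Y with X ≟ᴮ Y
... | yes refl = yes refl
... | no X≢Y   = no λ { refl → X≢Y refl }

free≢forced : ∀ {X} → free ≢ forced X
free≢forced ()

towards : Kind → Bool → Bool
towards free       b = b
towards (forced X) _ = X

-- They only
-- involve finitely many labels, so each comes with a decision procedure;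
-- for the concrete recolourings they are checked by evaluation.
module LabelConditions {k : ℕ} (kind : Fin k → Kind) (H : Fin k → Fin k → Bool) where

  ForcedEdges : Bool → Set
  ForcedEdges X = ∀ ℓ ℓ' → kind ℓ ≡ forced X → kind ℓ' ≡ forced X → H ℓ ℓ' ≢ X

  ForcedTriangles : Bool → Set
  ForcedTriangles X = ∀ r o o' → kind r ≡ forced X → kind o ≡ free → kind o' ≡ free →
    o ≢ o' → H r o ≡ X → H r o' ≡ X → H o o' ≢ X

  FreeTriangles : Bool → Set
  FreeTriangles X = ∀ o o' o'' → kind o ≡ free → kind o' ≡ free → kind o'' ≡ free →
    o ≢ o' → o' ≢ o'' → o ≢ o'' → H o o' ≡ X → H o' o'' ≡ X → H o o'' ≢ X

  NoTriangle : Bool → Set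
  NoTriangle X = ∀ ℓ ℓ' ℓ'' → H ℓ ℓ' ≡ X → H ℓ' ℓ'' ≡ X → H ℓ ℓ'' ≢ X

  FreeAvoids : Bool → Set
  FreeAvoids X = (∀ ℓ → kind ℓ ≢ forced X) ×
                 (∀ o o' → kind o ≡ free → kind o' ≡ free → o ≢ o' → H o o' ≢ X)

  -- A vertex labelled ℓ cannot lie in an X-clique beside a vertex labelled p:
  -- either the labels are not joined in X, or they coincide and belong to a
  -- single (free) vertex.
  Separated : Bool → Fin k → Fin k → Set
  Separated X ℓ p = H ℓ p ≢ X ⊎ (ℓ ≡ p × kind p ≡ free)

  -- Every label that can occur in an X-clique containing vertices labelled by
  -- the pivots Π and none labelled by `absent` is listed in Λ.
  Covering : Bool → List (Fin k) → List (Fin k) → List (Fin k) → Set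
  Covering X Π absent Λ = ∀ ℓ → ℓ ∈ absent ⊎ ℓ ∈ Λ ⊎ Any (Separated X ℓ) Π

  private
    open import Data.List.Membership.DecPropositional (_≟_ {k}) using (_∈?_)
    _≟ᴴ_ : ∀ ℓ ℓ' → {X : Bool} → Dec (H ℓ ℓ' ≡ X)
    (ℓ ≟ᴴ ℓ') {X} = H ℓ ℓ' ≟ᴮ X
    is-free? : ∀ ℓ → Dec (kind ℓ ≡ free)
    is-free? ℓ = kind ℓ ≟ᴷ free

  forced-edges? : ∀ X → Dec (ForcedEdges X)
  forced-edges? X = all? λ ℓ → all? λ ℓ' →
    (kind ℓ ≟ᴷ forced X) →-dec (kind ℓ' ≟ᴷ forced X) →-dec ¬? (ℓ ≟ᴴ ℓ')

  forced-triangles? : ∀ X → Dec (ForcedTriangles X)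
  forced-triangles? X = all? λ r → all? λ o → all? λ o' →
    (kind r ≟ᴷ forced X) →-dec is-free? o →-dec is-free? o' →-dec ¬? (o ≟ o') →-dec
    (r ≟ᴴ o) →-dec (r ≟ᴴ o') →-dec ¬? (o ≟ᴴ o')

  free-triangles? : ∀ X → Dec (FreeTriangles X)
  free-triangles? X = all? λ o → all? λ o' → all? λ o'' →
    is-free? o →-dec is-free? o' →-dec is-free? o'' →-dec
    ¬? (o ≟ o') →-dec ¬? (o' ≟ o'') →-dec ¬? (o ≟ o'') →-dec
    (o ≟ᴴ o') →-dec (o' ≟ᴴ o'') →-dec ¬? (o ≟ᴴ o'')

  no-triangle? : ∀ X → Dec (NoTriangle X)
  no-triangle? X = all? λ ℓ → all? λ ℓ' → all? λ ℓ'' →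
    (ℓ ≟ᴴ ℓ') →-dec (ℓ' ≟ᴴ ℓ'') →-dec ¬? (ℓ ≟ᴴ ℓ'')

  free-avoids? : ∀ X → Dec (FreeAvoids X)
  free-avoids? X =
    (all? λ ℓ → ¬? (kind ℓ ≟ᴷ forced X)) ×-dec
    (all? λ o → all? λ o' →
      is-free? o →-dec is-free? o' →-dec ¬? (o ≟ o') →-dec ¬? (o ≟ᴴ o'))

  covering? : ∀ X Π absent Λ → Dec (Covering X Π absent Λ)
  covering? X Π absent Λ = all? λ ℓ →
    (ℓ ∈? absent) ⊎-dec (ℓ ∈? Λ) ⊎-dec
    anyᴸ? (λ p → ¬? (ℓ ≟ᴴ p) ⊎-dec ((ℓ ≟ p) ×-dec is-free? p)) Π

both-colours : ∀ {P : Bool → Set} → P true → P false → ∀ X → P X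
both-colours p _ true  = p
both-colours _ p false = p

record Scheme (G : Graph) : Set where
  field
    k      : ℕ
    kind   : Fin k → Kind
    H      : Fin k → Fin k → Bool
    H-sym  : ∀ ℓ ℓ' → H ℓ ℓ' ≡ H ℓ' ℓ
    size   : Fin k → ℕ
    member : (ℓ : Fin k) → Fin (size ℓ) → Fin (v G)
    label  : Fin (v G) → Maybe (Fin k)
    label-sound      : ∀ {u ℓ} → label u ≡ just ℓ → u ∈Img member ℓ
    free-singleton   : ∀ {ℓ} → kind ℓ ≡ free → (i j : Fin (size ℓ)) → member ℓ i ≡ member ℓ j
  open LabelConditions kind H public
  field
    forced-edges     : ∀ X → ForcedEdges X
    forced-triangles : ∀ X → ForcedTriangles X
    free-triangles   : ∀ X → FreeTriangles X

-- The last
-- label contributes its size without a trailing `+ 0`, so that for concrete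
-- lists the total is a closed expression in the sizes.
module Classes {G : Graph} (Sc : Scheme G) where
  open Scheme Sc

  total : List (Fin k) → ℕ
  total []           = 0
  total (ℓ ∷ [])     = size ℓ
  total (ℓ ∷ ℓ' ∷ Λ) = size ℓ + total (ℓ' ∷ Λ)

  classes : (Λ : List (Fin k)) → Fin (total Λ) → Fin (v G)
  classes []           ()
  classes (ℓ ∷ [])     = member ℓ
  classes (ℓ ∷ ℓ' ∷ Λ) = member ℓ ++ classes (ℓ' ∷ Λ)

  in-classes : ∀ {u ℓ Λ} → ℓ ∈ Λ → u ∈Img member ℓ → u ∈Img classes Λ
  in-classes {Λ = _ ∷ []}     (here refl) u∈ = u∈
  in-classes {Λ = _ ∷ _ ∷ _} (here refl) (i , e) = i ↑ˡ _ , trans e (sym (lookup-++ˡ _ _ i))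
  in-classes {Λ = ℓ ∷ _ ∷ _} (there ℓ∈) u∈ with in-classes ℓ∈ u∈
  ... | i , e = size ℓ ↑ʳ i , trans e (sym (lookup-++ʳ (member ℓ) _ i))

module Recolouring {G : Graph} (c : Colouring G) (Sc : Scheme G) where
  open Scheme Sc
  open Classes Sc

  recolour : Maybe (Fin k) → Maybe (Fin k) → Bool → Bool
  recolour (just ℓ) (just ℓ') b = H ℓ ℓ'
  recolour (just ℓ) nothing   b = towards (kind ℓ) b
  recolour nothing  (just ℓ') b = towards (kind ℓ') b
  recolour nothing  nothing   b = b

  recolour-sym : ∀ x y b → recolour x y b ≡ recolour y x b
  recolour-sym (just ℓ) (just ℓ') b = H-sym ℓ ℓ'
  recolour-sym (just ℓ) nothing   b = refl
  recolour-sym nothing  (just ℓ') b = refl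
  recolour-sym nothing  nothing   b = refl

  col′ : Fin (v G) → Fin (v G) → Bool
  col′ u w = recolour (label u) (label w) (col c u w)

  c′ : Colouring G
  c′ = record { col = col′ ; col-sym = λ u w →
         trans (cong (recolour (label u) (label w)) (col-sym c u w))
               (recolour-sym (label u) (label w) (col c w u)) }

  -- Vertices that keep their colours towards each other: unlabelled vertices
  -- and vertices with a free label.
  data Plain : Maybe (Fin k) → Set where
    outside  : Plain nothing
    free-lab : ∀ {ℓ} → kind ℓ ≡ free → Plain (just ℓ)

  Labelled : Fin (v G) → Set
  Labelled u = label u ≢ nothing

  AtMostOneLabelled : ∀ {m} → (Fin m → Fin (v G)) → Set
  AtMostOneLabelled f = ∀ a a' → Labelled (f a) → Labelled (f a') → a ≡ a'

  recolour-plain : ∀ {x y} b → Plain x → Plain y → (x ≢ nothing → y ≢ nothing → ⊥) →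
                   recolour x y b ≡ b
  recolour-plain b outside      outside      _   = refl
  recolour-plain b outside      (free-lab e) _   = cong (λ κ → towards κ b) e
  recolour-plain b (free-lab e) outside      _   = cong (λ κ → towards κ b) e
  recolour-plain b (free-lab _) (free-lab _) two = ⊥-elim (two (λ ()) (λ ()))

  PlainClique : Bool → ℕ → Set
  PlainClique X m = Σ (Clique G (col c) X m) λ Q →
    (∀ a → Plain (label (proj₁ Q a))) × AtMostOneLabelled (proj₁ Q)

  -- On such vertices c′ agrees with c.
  plain-clique : ∀ {X m} (T : Clique G col′ X m) → (∀ a → Plain (label (proj₁ T a))) →
                 AtMostOneLabelled (proj₁ T) → PlainClique X m
  plain-clique (f , f-inj , f-mono) plain one =
    (f , f-inj , λ {a} {a'} a≢a' → proj₁ (f-mono a≢a') ,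
      trans (sym (recolour-plain _ (plain a) (plain a') λ la la' → a≢a' (one a a' la la')))
            (proj₂ (f-mono a≢a'))) ,
    plain , one

  labelled-plain : ∀ {x} → Plain x → x ≢ nothing → ∃ λ ℓ → x ≡ just ℓ × kind ℓ ≡ free
  labelled-plain outside      x≢ = ⊥-elim (x≢ refl)
  labelled-plain (free-lab e) _  = _ , refl , e

  module OfClique {X m} (T : Clique G col′ X m) where
    f : Fin m → Fin (v G)
    f = proj₁ T

    inner : ∀ {a a' ℓ ℓ'} → a ≢ a' → label (f a) ≡ just ℓ → label (f a') ≡ just ℓ' → H ℓ ℓ' ≡ X
    inner {a} {a'} a≢a' e e' =
      trans (cong₂ (λ x y → recolour x y (col c (f a) (f a'))) (sym e) (sym e'))
            (proj₂ (proj₂ (proj₂ T) a≢a'))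

    free-once : ∀ {a a' ℓ} → label (f a) ≡ just ℓ → label (f a') ≡ just ℓ → kind ℓ ≡ free → a ≡ a'
    free-once {ℓ = ℓ} e e' kℓ with label-sound e | label-sound e'
    ... | i , fa≡ | i' , fa'≡ =
      proj₁ (proj₂ T) (trans fa≡ (trans (free-singleton kℓ i i') (sym fa'≡)))

    distinct-free : ∀ {a a' ℓ ℓ'} → a ≢ a' → label (f a) ≡ just ℓ → label (f a') ≡ just ℓ' →
                    kind ℓ ≡ free → ℓ ≢ ℓ'
    distinct-free a≢a' e e' kℓ refl = a≢a' (free-once e e' kℓ)

  outside-or-inside : ∀ {X m} (T : Clique G col′ X m) →
    (∃ λ o → label (proj₁ T o) ≡ nothing) ⊎
    (Σ (Fin m → Fin k) λ lab → ∀ a → label (proj₁ T a) ≡ just (lab a))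
  outside-or-inside (f , _) with any? (λ a → ≡-dec-Maybe _≟_ (label (f a)) nothing)
  ... | yes out = inj₁ out
  ... | no none = inj₂ (proj₁ ∘ labelled , proj₂ ∘ labelled)
    where
    labelled : ∀ a → ∃ λ ℓ → label (f a) ≡ just ℓ
    labelled a with label (f a) in e
    ... | just ℓ  = ℓ , refl
    ... | nothing = ⊥-elim (none (a , e))

  -- Every vertex of T is unlabelled, free or forced to
  -- X (its edge to o has colour X), and deleting a suitable vertex leaves a
  -- plain X-clique of c.
  module Extraction {X n} (T : Clique G col′ X (suc n)) (o : Fin (suc n))
                    (o-out : label (proj₁ T o) ≡ nothing) where
    open OfClique T

    data Allowed : Maybe (Fin k) → Set where
      outside    : Allowed nothing
      free-lab   : ∀ {ℓ} → kind ℓ ≡ free → Allowed (just ℓ)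
      forced-lab : ∀ {ℓ} → kind ℓ ≡ forced X → Allowed (just ℓ)

    allowed-by : ∀ x b → recolour x nothing b ≡ X → Allowed x
    allowed-by nothing  b _ = outside
    allowed-by (just ℓ) b e = by-kind (kind ℓ) refl e
      where
      by-kind : ∀ κ → kind ℓ ≡ κ → towards κ b ≡ X → Allowed (just ℓ)
      by-kind free       kℓ _    = free-lab kℓ
      by-kind (forced Y) kℓ Y≡X = forced-lab (trans kℓ (cong forced Y≡X))

    allowed : ∀ a → Allowed (label (f a))
    allowed a with a ≟ o
    ... | yes refl = subst Allowed (sym o-out) outside
    ... | no a≢o   = allowed-by (label (f a)) (col c (f a) (f o))
      (trans (cong (λ y → recolour (label (f a)) y (col c (f a) (f o))) (sym o-out))
             (proj₂ (proj₂ (proj₂ T) a≢o)))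

    Forced FreeLabelled : Maybe (Fin k) → Set
    Forced       x = ∃ λ ℓ → x ≡ just ℓ × kind ℓ ≡ forced X
    FreeLabelled x = ∃ λ ℓ → x ≡ just ℓ × kind ℓ ≡ free

    forced? : ∀ {x} → Allowed x → Dec (Forced x)
    forced? outside        = no λ { (_ , () , _) }
    forced? (free-lab e)   = no λ { (_ , refl , e') → free≢forced (trans (sym e) e') }
    forced? (forced-lab e) = yes (_ , refl , e)

    free? : ∀ {x} → Allowed x → Dec (FreeLabelled x)
    free? outside        = no λ { (_ , () , _) }
    free? (free-lab e)   = yes (_ , refl , e)
    free? (forced-lab e) = no λ { (_ , refl , e') → free≢forced (trans (sym e') e) }

    plain-unless-forced : ∀ {x} → Allowed x → ¬ Forced x → Plain x
    plain-unless-forced outside        _  = outside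
    plain-unless-forced (free-lab e)   _  = free-lab e
    plain-unless-forced (forced-lab e) nf = ⊥-elim (nf (_ , refl , e))

    only-outside : ∀ {x} → Allowed x → ¬ FreeLabelled x → ¬ Forced x → x ≡ nothing
    only-outside outside        _  _  = refl
    only-outside (free-lab e)   nf _  = ⊥-elim (nf (_ , refl , e))
    only-outside (forced-lab e) _  nf = ⊥-elim (nf (_ , refl , e))

    keep-all-but : (j : Fin (suc n)) → (∀ i → Plain (label (f (punchIn j i)))) →
                   AtMostOneLabelled (f ∘ punchIn j) → PlainClique X n
    keep-all-but j = plain-clique (delete {G} {col′} T j)

    module _ (j : Fin (suc n)) where
      j≢ : ∀ i → j ≢ punchIn j i
      j≢ i e = punchInᵢ≢i j i (sym e)
      apart : ∀ {i i'} → i ≢ i' → punchIn j i ≢ punchIn j i'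
      apart i≢i' e = i≢i' (punchIn-injective j _ _ e)

    extract : PlainClique X n
    extract with any? (λ a → forced? (allowed a))
    -- delete a vertex j forced to X: no other vertex is forced to X (it would
    -- be joined to j in colour X) and two free vertices would span an
    -- X-triangle with j
    ... | yes (j , r , ej , kr) = keep-all-but j plain one
      where
      plain : ∀ i → Plain (label (f (punchIn j i)))
      plain i = plain-unless-forced (allowed _) λ { (r' , e' , kr') →
        forced-edges X r r' kr kr' (inner (j≢ j i) ej e') }
      one : AtMostOneLabelled (f ∘ punchIn j)
      one i i' li li' with i ≟ i'
      ... | yes i≡i' = i≡i'
      ... | no i≢i' with labelled-plain (plain i) li | labelled-plain (plain i') li'
      ...   | o₁ , e₁ , k₁ | o₂ , e₂ , k₂ = ⊥-elim (forced-triangles X r o₁ o₂ kr k₁ k₂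
              (distinct-free (apart j i≢i') e₁ e₂ k₁)
              (inner (j≢ j i) ej e₁) (inner (j≢ j i') ej e₂) (inner (apart j i≢i') e₁ e₂))
    -- otherwise delete a free vertex j: two more free vertices would span an
    -- X-triangle with it
    ... | no no-forced with any? (λ a → free? (allowed a))
    ...   | yes (j , o₀ , ej , k₀) = keep-all-but j plain one
      where
      plain : ∀ i → Plain (label (f (punchIn j i)))
      plain i = plain-unless-forced (allowed _) λ fo → no-forced (_ , fo)
      one : AtMostOneLabelled (f ∘ punchIn j)
      one i i' li li' with i ≟ i'
      ... | yes i≡i' = i≡i'
      ... | no i≢i' with labelled-plain (plain i) li | labelled-plain (plain i') li'
      ...   | o₁ , e₁ , k₁ | o₂ , e₂ , k₂ = ⊥-elim (free-triangles X o₀ o₁ o₂ k₀ k₁ k₂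
              (distinct-free (j≢ j i) ej e₁ k₀) (distinct-free (apart j i≢i') e₁ e₂ k₁)
              (distinct-free (j≢ j i') ej e₂ k₀)
              (inner (j≢ j i) ej e₁) (inner (apart j i≢i') e₁ e₂) (inner (j≢ j i') ej e₂))
    ...   | no no-free = keep-all-but zero (λ i → plain-unless-forced (allowed _) λ fo → no-forced (_ , fo))
                           (λ i _ li _ → ⊥-elim (li (only-outside (allowed (punchIn zero i))
                              (λ fl → no-free (_ , fl)) (λ fo → no-forced (_ , fo)))))

    plain-whole : FreeAvoids X → PlainClique X (suc n)
    plain-whole (unforced , apart-free) = plain-clique T plain one
      where
      plain : ∀ a → Plain (label (f a))
      plain a = plain-unless-forced (allowed a) λ { (ℓ , _ , kℓ) → unforced ℓ kℓ }
      one : AtMostOneLabelled f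
      one a a' la la' with a ≟ a'
      ... | yes a≡a' = a≡a'
      ... | no a≢a' with labelled-plain (plain a) la | labelled-plain (plain a') la'
      ...   | o₁ , e₁ , k₁ | o₂ , e₂ , k₂ =
        ⊥-elim (apart-free o₁ o₂ k₁ k₂ (distinct-free a≢a' e₁ e₂ k₁) (inner a≢a' e₁ e₂))

  beside-labelled : ∀ {X n n'} (S : Clique G (col c) X (suc n)) → (∀ i → Labelled (proj₁ S i)) →
    (T : Clique G col′ X (suc n')) (o : Fin (suc n')) → label (proj₁ T o) ≡ nothing →
    MonoCopy G c X (Fin n ⊎ Fin n') TwoCliqueAdj
  beside-labelled S S-lab T o o-out with Extraction.extract T o o-out
  ... | Q , _ , one = share-at-most-one c S Q λ {a} {a'} {i} {i'} e e' →
    one a a' (λ l → S-lab i (subst (λ u → label u ≡ nothing) e l))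
             (λ l → S-lab i' (subst (λ u → label u ≡ nothing) e' l))

  module Inside {X m} (T : Clique G col′ X m) (lab : Fin m → Fin k)
                (lab-eq : ∀ a → label (proj₁ T a) ≡ just (lab a)) where
    open OfClique T

    inner-lab : ∀ {a a'} → a ≢ a' → H (lab a) (lab a') ≡ X
    inner-lab a≢a' = inner a≢a' (lab-eq _) (lab-eq _)

    Occurs : Fin k → Set
    Occurs ℓ = ∃ λ a → lab a ≡ ℓ

    occurs? : ∀ ℓ → Dec (Occurs ℓ)
    occurs? ℓ = any? λ a → lab a ≟ ℓ

    at-most-two : NoTriangle X → 2 < m → ⊥
    at-most-two no-tri (s≤s (s≤s (s≤s _))) =
      no-tri (lab 0F) (lab 1F) (lab 2F) (inner-lab (λ ())) (inner-lab (λ ())) (inner-lab (λ ()))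

    pivot : ∀ {Π} → All Occurs Π → Fin (length Π) → Fin m
    pivot (occ ∷ _)    zero    = proj₁ occ
    pivot (_   ∷ occs) (suc i) = pivot occs i

    beside-pivots : ∀ {Π} (occs : All Occurs Π) a → (∀ i → a ≢ pivot occs i) →
                    ¬ Any (Separated X (lab a)) Π
    beside-pivots ((a₀ , refl) ∷ _) a a≢ (here (inj₁ not-X)) = not-X (inner-lab (a≢ zero))
    beside-pivots ((a₀ , refl) ∷ _) a a≢ (here (inj₂ (same , kp))) =
      a≢ zero (free-once (trans (lab-eq a) (cong just same)) (lab-eq a₀) kp)
    beside-pivots (_ ∷ occs) a a≢ (there sep) = beside-pivots occs a (a≢ ∘ suc) sep

    -- Covering argument: if T contains the pivot labels Π, avoids the labels
    -- in `absent`, and every other label it may contain is listed in Λ, then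
    -- T is listed by the pivot vertices together with the classes of Λ, so
    -- these are at least as many as T has vertices.
    no-cover : ∀ Π → All Occurs Π → ∀ absent → All (¬_ ∘ Occurs) absent → ∀ Λ →
               {cover : True (covering? X Π absent Λ)} → length Π + total Λ < m → ⊥
    no-cover Π occs absent none Λ {cover} small =
      no-short-listing f (proj₁ (proj₂ T)) (pivots ++ classes Λ) small listed
      where
      pivots : Fin (length Π) → Fin (v G)
      pivots = f ∘ pivot occs
      listed : ∀ a → f a ∈Img (pivots ++ classes Λ)
      listed a with any? (λ i → a ≟ pivot occs i)
      ... | yes (i , a≡) = i ↑ˡ total Λ , trans (cong f a≡) (sym (lookup-++ˡ pivots (classes Λ) i))
      ... | no not-pivot with toWitness cover (lab a)
      ...   | inj₁ ∈absent     = ⊥-elim (lookupᴬ none ∈absent (a , refl))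
      ...   | inj₂ (inj₂ sep)  = ⊥-elim (beside-pivots occs a (λ i e → not-pivot (i , e)) sep)
      ...   | inj₂ (inj₁ ∈Λ) with in-classes ∈Λ (label-sound (lab-eq a))
      ...     | j , e = length Π ↑ʳ j , trans e (sym (lookup-++ʳ pivots (classes Λ) j))

-- Step 1.  S is a red K_{n+1} on s₀, …, sₙ (n = m + 4).  Inside S only
-- s₀s₁, s₀s₂ and s₁s₃ stay red; edges from outside to s₂, …, sₙ become red;
-- all other colours are kept.  A monochromatic K_n of this recolouring
-- either lies in S, which is impossible, or gives the required K_n + K_{n-1}
-- in red, or a blue K_n of c meeting S at most in s₀ or s₁.
module Step1 {G : Graph} (c : Colouring G) (m : ℕ) (S : Clique G (col c) true (5 + m)) where
  s : Fin (5 + m) → Fin (v G)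
  s = proj₁ S

  -- labels: o₀, o₁ (the free vertices s₀, s₁), r₂, r₃ (s₂, s₃) and r₄₊
  -- (s₄, …, sₙ), the last three forced red
  pattern o₀  = 0F
  pattern o₁  = 1F
  pattern r₂  = 2F
  pattern r₃  = 3F
  pattern r₄₊ = 4F

  kind₁ : Fin 5 → Kind
  kind₁ o₀ = free
  kind₁ o₁ = free
  kind₁ _  = forced true

  red-pair : Fin 5 → Fin 5 → Bool
  red-pair o₀ o₁ = true
  red-pair o₀ r₂ = true
  red-pair o₁ r₃ = true
  red-pair _  _  = false

  H₁ : Fin 5 → Fin 5 → Bool
  H₁ ℓ ℓ' = red-pair ℓ ℓ' ∨ red-pair ℓ' ℓ

  size₁ : Fin 5 → ℕ
  size₁ r₄₊ = suc m
  size₁ _   = 1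

  member₁ : (ℓ : Fin 5) → Fin (size₁ ℓ) → Fin (v G)
  member₁ o₀  _ = s 0F
  member₁ o₁  _ = s 1F
  member₁ r₂  _ = s 2F
  member₁ r₃  _ = s 3F
  member₁ r₄₊ i = s (suc (suc (suc (suc i))))

  Evidence₁ : Fin (v G) → Maybe (Fin 5) → Set
  Evidence₁ u (just ℓ) = u ∈Img member₁ ℓ
  Evidence₁ u nothing  = ∀ i → u ≢ s i

  at-index : ∀ {u} i → u ≡ s i → Σ (Maybe (Fin 5)) (Evidence₁ u)
  at-index 0F e = just o₀ , 0F , e
  at-index 1F e = just o₁ , 0F , e
  at-index 2F e = just r₂ , 0F , e
  at-index 3F e = just r₃ , 0F , e
  at-index (suc (suc (suc (suc i)))) e = just r₄₊ , i , e

  classify₁ : ∀ u → Σ (Maybe (Fin 5)) (Evidence₁ u)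
  classify₁ u with u ∈Img? s
  ... | yes (i , e) = at-index i e
  ... | no ∉S       = nothing , λ i e → ∉S (i , e)

  open LabelConditions kind₁ H₁

  scheme₁ : Scheme G
  scheme₁ = record
    { k = 5 ; kind = kind₁ ; H = H₁
    ; H-sym = λ ℓ ℓ' → ∨-comm (red-pair ℓ ℓ') (red-pair ℓ' ℓ)
    ; size = size₁ ; member = member₁ ; label = proj₁ ∘ classify₁
    ; label-sound = λ {u} e → subst (Evidence₁ u) e (proj₂ (classify₁ u))
    ; free-singleton = λ { {o₀} _ _ _ → refl ; {o₁} _ _ _ → refl ; {suc (suc _)} () }
    ; forced-edges = both-colours (from-yes (forced-edges? true)) (from-yes (forced-edges? false))
    ; forced-triangles = both-colours (from-yes (forced-triangles? true)) (from-yes (forced-triangles? false))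
    ; free-triangles = both-colours (from-yes (free-triangles? true)) (from-yes (free-triangles? false))
    }

  open Recolouring c scheme₁

  c₁ : Colouring G
  c₁ = c′

  S-labelled : ∀ i → Labelled (s i)
  S-labelled i e = subst (Evidence₁ (s i)) e (proj₂ (classify₁ (s i))) i refl

  plain-in-S : ∀ {u} x → Evidence₁ u x → Plain x → ∀ {i} → u ≡ s i → i ≡ 0F ⊎ i ≡ 1F
  plain-in-S nothing     ∉S         outside       e = ⊥-elim (∉S _ e)
  plain-in-S (just o₀)   (_ , u≡s₀) (free-lab _) e = inj₁ (proj₁ (proj₂ S) (trans (sym e) u≡s₀))
  plain-in-S (just o₁)   (_ , u≡s₁) (free-lab _) e = inj₂ (proj₁ (proj₂ S) (trans (sym e) u≡s₁))
  plain-in-S (just (suc (suc _))) _ (free-lab ()) _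

  BlueBeside : Set
  BlueBeside = Σ (Clique G (col c) false (4 + m)) λ B → ∀ a i → proj₁ B a ≡ s i → i ≡ 0F ⊎ i ≡ 1F

  outcome : MonoK G c′ (4 + m) → MonoKK G c (4 + m) (3 + m) ⊎ BlueBeside
  outcome (X , T) with outside-or-inside T
  outcome (true , T)  | inj₁ (o , o-out) = inj₁ (true , beside-labelled S S-labelled T o o-out)
  -- a blue K_n through an outside vertex is a blue K_n of c
  outcome (false , T) | inj₁ (o , o-out)
    with Extraction.plain-whole T o o-out (from-yes (free-avoids? false))
  ... | B , plain , _ = inj₂ (B , λ a i e → plain-in-S _ (proj₂ (classify₁ (proj₁ B a))) (plain a) e)
  -- S contains no red triangle
  outcome (true , T)  | inj₂ (lab , lab-eq) =
    ⊥-elim (at-most-two (from-yes (no-triangle? true)) (s≤s (s≤s (s≤s z≤n))))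
    where open Inside T lab lab-eq
  -- nor a blue K_n: it would be listed by fewer than n vertices
  outcome (false , T) | inj₂ (lab , lab-eq) = ⊥-elim no-blue
    where
    open Inside T lab lab-eq
    no-blue : ⊥
    no-blue with occurs? o₀
    ... | yes occ₀ = no-cover (o₀ ∷ []) (occ₀ ∷ []) [] [] (r₃ ∷ r₄₊ ∷ []) ≤-refl
    ... | no  no₀ with occurs? o₁
    ...   | yes occ₁ = no-cover (o₁ ∷ []) (occ₁ ∷ []) (o₀ ∷ []) (no₀ ∷ []) (r₂ ∷ r₄₊ ∷ []) ≤-refl
    ...   | no  no₁  = no-cover [] [] (o₀ ∷ o₁ ∷ []) (no₀ ∷ no₁ ∷ []) (r₂ ∷ r₃ ∷ r₄₊ ∷ []) ≤-refl

-- Step 2.  Besides the red K_{n+1} S on s₀, …, sₙ there is a blue K_n B on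
-- w = b₀, b₁, …, b_{n-1} meeting S at most in s₀ or s₁.  Recolour inside
-- S ∪ B so that neither colour has a K_n there, with s₂, s₃, s₄ free, s₀, s₁,
-- w, s₅, …, sₙ forced red and b₁, …, b_{n-1} forced blue.  A monochromatic
-- K_n of the recolouring then passes outside, and extraction gives a red K_{n-1}
-- meeting S at most once or a blue K_{n-1} disjoint from B.
module Step2 {G : Graph} (c : Colouring G) (m : ℕ) (S : Clique G (col c) true (5 + m))
             (B : Clique G (col c) false (4 + m))
             (B∩S : ∀ a i → proj₁ B a ≡ proj₁ S i → i ≡ 0F ⊎ i ≡ 1F) where
  s : Fin (5 + m) → Fin (v G)
  s = proj₁ S
  b : Fin (4 + m) → Fin (v G)
  b = proj₁ B

  -- labels: free o₂, o₃, o₄ (s₂, s₃, s₄); forced red r₀, r₁ (s₀, s₁) and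
  -- r₅₊ (w, s₅, …, sₙ); forced blue b₁, b₂, b₃ and b₄₊ (b₄, …, b_{n-1})
  pattern o₂  = 0F
  pattern o₃  = 1F
  pattern o₄  = 2F
  pattern r₀  = 3F
  pattern r₁  = 4F
  pattern r₅₊ = 5F
  pattern b₁  = 6F
  pattern b₂  = 7F
  pattern b₃  = 8F
  pattern b₄₊ = 9F

  kind₂ : Fin 10 → Kind
  kind₂ o₂  = free
  kind₂ o₃  = free
  kind₂ o₄  = free
  kind₂ r₀  = forced true
  kind₂ r₁  = forced true
  kind₂ r₅₊ = forced true
  kind₂ _   = forced false

  -- the blue labels span a red clique; the other red pairs are listed once
  blue-label : Fin 10 → Bool
  blue-label b₁  = true
  blue-label b₂  = true
  blue-label b₃  = true
  blue-label b₄₊ = true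
  blue-label _   = false

  red-pair : Fin 10 → Fin 10 → Bool
  red-pair o₂ o₃  = true
  red-pair o₂ o₄  = true
  red-pair o₂ r₀  = true
  red-pair o₂ b₃  = true
  red-pair o₂ b₄₊ = true
  red-pair o₃ r₁  = true
  red-pair o₃ r₅₊ = true
  red-pair o₃ b₂  = true
  red-pair o₃ b₃  = true
  red-pair o₃ b₄₊ = true
  red-pair o₄ r₁  = true
  red-pair o₄ r₅₊ = true
  red-pair o₄ b₁  = true
  red-pair o₄ b₃  = true
  red-pair o₄ b₄₊ = true
  red-pair r₀ b₃  = true
  red-pair r₁ b₁  = true
  red-pair r₁ b₂  = true
  red-pair r₁ b₄₊ = true
  red-pair _  _   = false

  H₂ : Fin 10 → Fin 10 → Bool
  H₂ ℓ ℓ' = (blue-label ℓ ∧ blue-label ℓ') ∨ (red-pair ℓ ℓ' ∨ red-pair ℓ' ℓ)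

  size₂ : Fin 10 → ℕ
  size₂ r₅₊ = suc m
  size₂ b₄₊ = m
  size₂ _   = 1

  member₂ : (ℓ : Fin 10) → Fin (size₂ ℓ) → Fin (v G)
  member₂ o₂  _       = s 2F
  member₂ o₃  _       = s 3F
  member₂ o₄  _       = s 4F
  member₂ r₀  _       = s 0F
  member₂ r₁  _       = s 1F
  member₂ r₅₊ zero    = b 0F
  member₂ r₅₊ (suc i) = s (suc (suc (suc (suc (suc i)))))
  member₂ b₁  _       = b 1F
  member₂ b₂  _       = b 2F
  member₂ b₃  _       = b 3F
  member₂ b₄₊ i       = b (suc (suc (suc (suc i))))

  Evidence₂ : Fin (v G) → Maybe (Fin 10) → Set
  Evidence₂ u (just ℓ) = u ∈Img member₂ ℓ
  Evidence₂ u nothing  = (∀ i → u ≢ s i) × (∀ i → u ≢ b i)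

  in-S : ∀ {u} i → u ≡ s i → Σ (Maybe (Fin 10)) (Evidence₂ u)
  in-S 0F e = just r₀ , 0F , e
  in-S 1F e = just r₁ , 0F , e
  in-S 2F e = just o₂ , 0F , e
  in-S 3F e = just o₃ , 0F , e
  in-S 4F e = just o₄ , 0F , e
  in-S (suc (suc (suc (suc (suc i))))) e = just r₅₊ , suc i , e

  in-B : ∀ {u} i → u ≡ b i → Σ (Maybe (Fin 10)) (Evidence₂ u)
  in-B 0F e = just r₅₊ , 0F , e
  in-B 1F e = just b₁ , 0F , e
  in-B 2F e = just b₂ , 0F , e
  in-B 3F e = just b₃ , 0F , e
  in-B (suc (suc (suc (suc i)))) e = just b₄₊ , i , e

  classify₂ : ∀ u → Σ (Maybe (Fin 10)) (Evidence₂ u)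
  classify₂ u with u ∈Img? s | u ∈Img? b
  ... | yes (i , e) | _           = in-S i e
  ... | no ∉S       | yes (i , e) = in-B i e
  ... | no ∉S       | no ∉B       = nothing , (λ i e → ∉S (i , e)) , (λ i e → ∉B (i , e))

  open LabelConditions kind₂ H₂

  scheme₂ : Scheme G
  scheme₂ = record
    { k = 10 ; kind = kind₂ ; H = H₂
    ; H-sym = λ ℓ ℓ' → cong₂ _∨_ (∧-comm (blue-label ℓ) (blue-label ℓ'))
                                 (∨-comm (red-pair ℓ ℓ') (red-pair ℓ' ℓ))
    ; size = size₂ ; member = member₂ ; label = proj₁ ∘ classify₂
    ; label-sound = λ {u} e → subst (Evidence₂ u) e (proj₂ (classify₂ u))
    ; free-singleton = λ { {o₂} _ _ _ → refl ; {o₃} _ _ _ → refl ; {o₄} _ _ _ → refl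
                         ; {r₀} () ; {r₁} () ; {r₅₊} () ; {suc (suc (suc (suc (suc (suc _)))))} () }
    ; forced-edges = both-colours (from-yes (forced-edges? true)) (from-yes (forced-edges? false))
    ; forced-triangles = both-colours (from-yes (forced-triangles? true)) (from-yes (forced-triangles? false))
    ; free-triangles = both-colours (from-yes (free-triangles? true)) (from-yes (free-triangles? false))
    }

  open Recolouring c scheme₂

  c₂ : Colouring G
  c₂ = c′

  S-labelled : ∀ i → Labelled (s i)
  S-labelled i e = proj₁ (subst (Evidence₂ (s i)) e (proj₂ (classify₂ (s i)))) i refl

  -- a plain vertex is not in B: B meets S at most in s₀, s₁
  plain-off-B : ∀ {u} x → Evidence₂ u x → Plain x → ∀ i → b i ≢ u
  plain-off-B nothing   (_ , ∉B)   outside      i e = ∉B i (sym e)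
  plain-off-B (just o₂) (_ , u≡s₂) (free-lab _) i e with B∩S i 2F (trans e u≡s₂)
  ... | inj₁ () 
  ... | inj₂ ()
  plain-off-B (just o₃) (_ , u≡s₃) (free-lab _) i e with B∩S i 3F (trans e u≡s₃)
  ... | inj₁ ()
  ... | inj₂ ()
  plain-off-B (just o₄) (_ , u≡s₄) (free-lab _) i e with B∩S i 4F (trans e u≡s₄)
  ... | inj₁ ()
  ... | inj₂ ()
  plain-off-B (just r₀)  _ (free-lab ()) _ _
  plain-off-B (just r₁)  _ (free-lab ()) _ _
  plain-off-B (just r₅₊) _ (free-lab ()) _ _
  plain-off-B (just (suc (suc (suc (suc (suc (suc _))))))) _ (free-lab ()) _ _

  3<n : 3 < 4 + m
  3<n = s≤s (s≤s (s≤s (s≤s z≤n)))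

  outcome : MonoK G c′ (4 + m) → MonoKK G c (4 + m) (3 + m)
  outcome (X , T) with outside-or-inside T
  outcome (true , T)  | inj₁ (o , o-out) = true , beside-labelled S S-labelled T o o-out
  outcome (false , T) | inj₁ (o , o-out) with Extraction.extract T o o-out
  ... | Q , plain , _ = false , disjoint-union c B Q
          λ i a → plain-off-B _ (proj₂ (classify₂ (proj₁ Q a))) (plain a) i
  -- no red K_n inside S ∪ B: it would be listed by fewer than n vertices
  outcome (true , T)  | inj₂ (lab , lab-eq) = ⊥-elim no-red
    where
    open Inside T lab lab-eq
    no-red : ⊥
    no-red with occurs? r₀
    ... | yes occ = no-cover (r₀ ∷ []) (occ ∷ []) [] [] (o₂ ∷ b₃ ∷ []) 3<n
    ... | no n₀ with occurs? r₁
    ...   | yes occ with occurs? o₃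
    ...     | yes occ' = no-cover (r₁ ∷ o₃ ∷ []) (occ ∷ occ' ∷ []) (r₀ ∷ []) (n₀ ∷ [])
                           (b₂ ∷ b₄₊ ∷ []) ≤-refl
    ...     | no n₃ with occurs? o₄
    ...       | yes occ' = no-cover (r₁ ∷ o₄ ∷ []) (occ ∷ occ' ∷ []) (r₀ ∷ o₃ ∷ []) (n₀ ∷ n₃ ∷ [])
                             (b₁ ∷ b₄₊ ∷ []) ≤-refl
    ...       | no n₄ = no-cover (r₁ ∷ []) (occ ∷ []) (r₀ ∷ o₃ ∷ o₄ ∷ []) (n₀ ∷ n₃ ∷ n₄ ∷ [])
                          (b₁ ∷ b₂ ∷ b₄₊ ∷ []) ≤-refl
    no-red | no n₀ | no n₁ with occurs? r₅₊
    ... | yes occ = no-cover (r₅₊ ∷ []) (occ ∷ []) (r₀ ∷ r₁ ∷ []) (n₀ ∷ n₁ ∷ []) (o₃ ∷ o₄ ∷ []) 3<n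
    ... | no n₅ with occurs? o₂
    ...   | yes occ with occurs? o₃
    ...     | yes occ' = no-cover (o₂ ∷ o₃ ∷ []) (occ ∷ occ' ∷ []) (r₀ ∷ r₁ ∷ r₅₊ ∷ [])
                           (n₀ ∷ n₁ ∷ n₅ ∷ []) (b₃ ∷ b₄₊ ∷ []) ≤-refl
    ...     | no n₃ with occurs? o₄
    ...       | yes occ' = no-cover (o₂ ∷ o₄ ∷ []) (occ ∷ occ' ∷ []) (r₀ ∷ r₁ ∷ r₅₊ ∷ o₃ ∷ [])
                             (n₀ ∷ n₁ ∷ n₅ ∷ n₃ ∷ []) (b₃ ∷ b₄₊ ∷ []) ≤-refl
    ...       | no n₄ = no-cover (o₂ ∷ []) (occ ∷ []) (r₀ ∷ r₁ ∷ r₅₊ ∷ o₃ ∷ o₄ ∷ [])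
                          (n₀ ∷ n₁ ∷ n₅ ∷ n₃ ∷ n₄ ∷ []) (b₃ ∷ b₄₊ ∷ []) (n≤1+n _)
    no-red | no n₀ | no n₁ | no n₅ | no n₂ with occurs? o₃
    ... | yes occ = no-cover (o₃ ∷ []) (occ ∷ []) (r₀ ∷ r₁ ∷ r₅₊ ∷ o₂ ∷ []) (n₀ ∷ n₁ ∷ n₅ ∷ n₂ ∷ [])
                      (b₂ ∷ b₃ ∷ b₄₊ ∷ []) ≤-refl
    ... | no n₃ with occurs? o₄
    ...   | yes occ = no-cover (o₄ ∷ []) (occ ∷ []) (r₀ ∷ r₁ ∷ r₅₊ ∷ o₂ ∷ o₃ ∷ [])
                        (n₀ ∷ n₁ ∷ n₅ ∷ n₂ ∷ n₃ ∷ []) (b₁ ∷ b₃ ∷ b₄₊ ∷ []) ≤-refl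
    ...   | no n₄ = no-cover [] [] (r₀ ∷ r₁ ∷ r₅₊ ∷ o₂ ∷ o₃ ∷ o₄ ∷ []) (n₀ ∷ n₁ ∷ n₅ ∷ n₂ ∷ n₃ ∷ n₄ ∷ [])
                      (b₁ ∷ b₂ ∷ b₃ ∷ b₄₊ ∷ []) ≤-refl
  outcome (false , T) | inj₂ (lab , lab-eq) = ⊥-elim no-blue
    where
    open Inside T lab lab-eq
    no-blue : ⊥
    no-blue with occurs? b₁
    ... | yes occ with occurs? o₂
    ...   | yes occ' = no-cover (b₁ ∷ o₂ ∷ []) (occ ∷ occ' ∷ []) [] [] (r₅₊ ∷ []) ≤-refl
    ...   | no n₂ with occurs? o₃
    ...     | yes occ' = no-cover (b₁ ∷ o₃ ∷ []) (occ ∷ occ' ∷ []) (o₂ ∷ []) (n₂ ∷ []) (r₀ ∷ []) 3<n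
    ...     | no n₃ = no-cover (b₁ ∷ []) (occ ∷ []) (o₂ ∷ o₃ ∷ []) (n₂ ∷ n₃ ∷ []) (r₀ ∷ r₅₊ ∷ []) ≤-refl
    no-blue | no m₁ with occurs? b₂
    ... | yes occ with occurs? o₂
    ...   | yes occ' = no-cover (b₂ ∷ o₂ ∷ []) (occ ∷ occ' ∷ []) (b₁ ∷ []) (m₁ ∷ []) (r₅₊ ∷ []) ≤-refl
    ...   | no n₂ with occurs? o₄
    ...     | yes occ' = no-cover (b₂ ∷ o₄ ∷ []) (occ ∷ occ' ∷ []) (b₁ ∷ o₂ ∷ []) (m₁ ∷ n₂ ∷ [])
                           (r₀ ∷ []) 3<n
    ...     | no n₄ = no-cover (b₂ ∷ []) (occ ∷ []) (b₁ ∷ o₂ ∷ o₄ ∷ []) (m₁ ∷ n₂ ∷ n₄ ∷ [])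
                        (r₀ ∷ r₅₊ ∷ []) ≤-refl
    no-blue | no m₁ | no m₂ with occurs? b₃
    ... | yes occ = no-cover (b₃ ∷ []) (occ ∷ []) (b₁ ∷ b₂ ∷ []) (m₁ ∷ m₂ ∷ []) (r₁ ∷ r₅₊ ∷ []) ≤-refl
    ... | no m₃ with occurs? b₄₊
    ...   | yes occ = no-cover (b₄₊ ∷ []) (occ ∷ []) (b₁ ∷ b₂ ∷ b₃ ∷ []) (m₁ ∷ m₂ ∷ m₃ ∷ [])
                        (r₀ ∷ r₅₊ ∷ []) ≤-refl
    ...   | no m₄ with occurs? o₂
    ...     | yes occ = no-cover (o₂ ∷ []) (occ ∷ []) (b₁ ∷ b₂ ∷ b₃ ∷ b₄₊ ∷ []) (m₁ ∷ m₂ ∷ m₃ ∷ m₄ ∷ [])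
                          (r₁ ∷ r₅₊ ∷ []) ≤-refl
    ...     | no n₂ with occurs? o₃
    ...       | yes occ = no-cover (o₃ ∷ []) (occ ∷ []) (b₁ ∷ b₂ ∷ b₃ ∷ b₄₊ ∷ o₂ ∷ [])
                            (m₁ ∷ m₂ ∷ m₃ ∷ m₄ ∷ n₂ ∷ []) (o₄ ∷ r₀ ∷ []) 3<n
    ...       | no n₃ with occurs? o₄
    ...         | yes occ = no-cover (o₄ ∷ []) (occ ∷ []) (b₁ ∷ b₂ ∷ b₃ ∷ b₄₊ ∷ o₂ ∷ o₃ ∷ [])
                              (m₁ ∷ m₂ ∷ m₃ ∷ m₄ ∷ n₂ ∷ n₃ ∷ []) (r₀ ∷ []) (s≤s (s≤s (s≤s z≤n)))
    ...         | no n₄ = no-cover [] [] (b₁ ∷ b₂ ∷ b₃ ∷ b₄₊ ∷ o₂ ∷ o₃ ∷ o₄ ∷ [])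
                            (m₁ ∷ m₂ ∷ m₃ ∷ m₄ ∷ n₂ ∷ n₃ ∷ n₄ ∷ []) (r₀ ∷ r₁ ∷ r₅₊ ∷ []) ≤-refl

red-case : ∀ m (G : Graph) → Arrows G (4 + m) → (c : Colouring G) →
           Clique G (col c) true (5 + m) → MonoKK G c (4 + m) (3 + m)
red-case m G arrows c S with Step1.outcome c m S (arrows (Step1.c₁ c m S))
... | inj₁ done       = done
... | inj₂ (B , B∩S) = Step2.outcome c m S B B∩S (arrows (Step2.c₂ c m S B B∩S))

-- A blue K_{n+1} is a red one after exchanging the colours.
lemma6 : (n : ℕ) → 4 ≤ n → (G : Graph) → Arrows G n →
         (c : Colouring G) → MonoK G c (suc n) → MonoKK G c n (n ∸ 1)
lemma6 (suc (suc (suc (suc m)))) (s≤s (s≤s (s≤s (s≤s _)))) G arrows c (true , S) =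
  red-case m G arrows c S
lemma6 (suc (suc (suc (suc m)))) (s≤s (s≤s (s≤s (s≤s _)))) G arrows c (false , S)
  with red-case m G arrows (swap c) (to-swap c S)
... | X , K = not X , from-swap c K
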